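{- Let $G$ be a finite group with identity $e$ and let $\mu_1,\dots,\mu_t\colon G\to G$ be bijections with $\mu_i(e)=e$ such that $\{(x,y,xy,x\mu_1(y),\dots,x\mu_t(y)):x,y\in G\}$ is an orthogonal array (a $G$-based set of MOLS). Then the autotopy group of this set of MOLS is isomorphic to a subgroup of $(G\times G)\rtimes\mathrm{Aut}(G)$ (with $\mathrm{Aut}(G)$ acting diagonally on $G\times G$), where $(a,b,\varphi)$ corresponds to the autotopy $(a\varphi,\ \varphi b^{ -1},\ a\varphi b^{ -1},\ a\varphi\mu_1(b^{ -1}),\dots,a\varphi\mu_t(b^{ -1}))$, i.e. to the maps $z\mapsto a\varphi(z)$, $z\mapsto\varphi(z)b^{ -1}$, $z\mapsto a\varphi(z)b^{ -1}$, $z\mapsto a\varphi(z)\mu_i(b^{ -1})$; and this subgroup contains $(G\times\{e\})\rtimes\{\mathrm{id}\}$.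
   Context: An orthogonal array with $t+3$ coordinates over $G$ is a set of $|G|^2$ tuples in $G^{t+3}$ such that any two coordinates contain every ordered pair exactly once; it encodes $t+1$ MOLS of order $|G|$. The autotopy group of such an array $S$ is the group of tuples $(\sigma_1,\dots,\sigma_{t+3})$ of bijections of $G$ whose coordinatewise action maps $S$ onto $S$. -}

module Defs where

open import Level using (0ℓ)
open import Data.Nat using (ℕ)
open import Data.Fin using (Fin; zero; suc)
open import Data.Product using (Σ; ∃; ∃₂; _×_; _,_)
open import Relation.Binary.PropositionalEquality using (_≡_)
open import Relation.Nullary using (¬_)
open import Algebra.Structures using (IsGroup)
open import Function.Bundles using (_↔_)
import Function.Definitions as FD

record FinGroup : Set₁ where
  infixl 7 _∙_
  field
    Carrier : Set
    _∙_     : Carrier → Carrier → Carrier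
    ε       : Carrier
    _⁻¹     : Carrier → Carrier
    isGroup : IsGroup _≡_ _∙_ ε _⁻¹
    size    : ℕ
    finite  : Carrier ↔ Fin size

module _ (G : FinGroup) where
  open FinGroup G

  Bij : (Carrier → Carrier) → Set
  Bij f = FD.Bijective _≡_ _≡_ f

  IsAut : (Carrier → Carrier) → Set
  IsAut φ = Bij φ × (∀ x y → φ (x ∙ y) ≡ φ x ∙ φ y)

  module _ (t : ℕ) (μ : Fin t → Carrier → Carrier) where

    row : Carrier → Carrier → Fin (3 Data.Nat.+ t) → Carrier
    row x y zero                   = x
    row x y (suc zero)             = y
    row x y (suc (suc zero))       = x ∙ y
    row x y (suc (suc (suc i)))    = x ∙ μ i y

    IsOA : Set
    IsOA = ∀ (i j : Fin (3 Data.Nat.+ t)) → ¬ (i ≡ j) → ∀ (u v : Carrier) →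
      Σ (Carrier × Carrier) λ where
        (x , y) → (row x y i ≡ u × row x y j ≡ v) ×
                  (∀ x' y' → row x' y' i ≡ u → row x' y' j ≡ v → (x' ≡ x × y' ≡ y))

    IsAutotopy : (Fin (3 Data.Nat.+ t) → Carrier → Carrier) → Set
    IsAutotopy σ =
      (∀ k → Bij (σ k)) ×
      (∀ x y → ∃₂ λ x' y' → ∀ k → σ k (row x y k) ≡ row x' y' k) ×
      (∀ x' y' → ∃₂ λ x y → ∀ k → σ k (row x y k) ≡ row x' y' k)

    -- elements (a , b , φ) of (G × G) ⋊ Aut(G) (φ required to be in Aut(G) separately)
    Triple : Set
    Triple = Carrier × Carrier × (Carrier → Carrier)

    Θ : Triple → Fin (3 Data.Nat.+ t) → Carrier → Carrier
    Θ (a , b , φ) zero                z = a ∙ φ z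
    Θ (a , b , φ) (suc zero)          z = φ z ∙ (b ⁻¹)
    Θ (a , b , φ) (suc (suc zero))    z = a ∙ φ z ∙ (b ⁻¹)
    Θ (a , b , φ) (suc (suc (suc i))) z = a ∙ φ z ∙ μ i (b ⁻¹)

    _·_ : Triple → Triple → Triple
    (a , b , φ) · (a' , b' , φ') = (a ∙ φ a' , b ∙ φ b' , λ z → φ (φ' z))

    e₃ : Triple
    e₃ = (ε , ε , λ z → z)

    _≈₃_ : Triple → Triple → Set
    (a , b , φ) ≈₃ (a' , b' , φ') = a ≡ a' × b ≡ b' × (∀ z → φ z ≡ φ' z)

    InH : Triple → Set
    InH (a , b , φ) = IsAut φ × IsAutotopy (Θ (a , b , φ))

{-# OPTIONS --safe #-}

-- An autotopy σ sends the row of (x , y) to the row of (σ₀ x , σ₁ y), so in particular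
-- σ₂ (x y) = σ₀ x · σ₁ y. With a = σ₀ e, c = σ₁ e and φ = a⁻¹ σ₀ this forces σ₁ = φ(·) c
-- and makes φ an automorphism; evaluating the last t coordinates at y = e gives
-- σ₃₊ᵢ z = a φ(z) μᵢ(c), so σ = Θ (a , c⁻¹ , φ), and the triple is recovered from σ₀ and σ₁.
-- Conversely Θ (a , b , φ) is an autotopy exactly when φ commutes with the μᵢ up to the
-- translation by b. On such triples Θ turns the semidirect-product law into coordinatewise
-- composition, so closure of H under products and inverses reduces to that of autotopies.

module Submission where

open import Defs
open import Level using (0ℓ)
open import Data.Nat using (ℕ; _+_)
open import Data.Fin using (Fin; zero; suc)
open import Data.Product using (Σ; ∃; ∃₂; _×_; _,_; proj₁; proj₂)
open import Function.Base using (id; _∘_)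
open import Function.Consequences.Propositional
  using (strictlySurjective⇒surjective; surjective⇒strictlySurjective)
import Function.Construct.Composition as Composition
open import Relation.Binary.PropositionalEquality
  using (_≡_; refl; sym; trans; cong; cong₂; subst₂; module ≡-Reasoning)
open import Algebra.Bundles using (Group)
open import Algebra.Structures using (IsGroup)
import Algebra.Properties.Group as GroupProperties

module _ (G : FinGroup) where
  open FinGroup G
  open IsGroup isGroup using (assoc; identityˡ; identityʳ; inverseˡ; inverseʳ)
  open ≡-Reasoning

  group : Group 0ℓ 0ℓ
  group = record
    { Carrier = Carrier ; _≈_ = _≡_ ; _∙_ = _∙_ ; ε = ε ; _⁻¹ = _⁻¹ ; isGroup = isGroup }

  open GroupProperties group
    using ( \\-leftDividesˡ; \\-leftDividesʳ; //-rightDividesˡ; ∙-cancelˡ; ∙-cancelʳ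
          ; ε⁻¹≈ε; ⁻¹-involutive; ⁻¹-injective; ⁻¹-anti-homo-∙
          ; identityˡ-unique; inverseʳ-unique)

  bij-∘ : ∀ {f g : Carrier → Carrier} → Bij G f → Bij G g → Bij G (g ∘ f)
  bij-∘ = Composition.bijective _≡_ _≡_ _≡_

  bij-resp : ∀ {f g : Carrier → Carrier} → Bij G f → (∀ z → f z ≡ g z) → Bij G g
  bij-resp {f} {g} (f-inj , f-surj) f≗g = g-inj , strictlySurjective⇒surjective g-surj
    where
    g-inj : ∀ {x y} → g x ≡ g y → x ≡ y
    g-inj {x} {y} gx≡gy = f-inj (trans (f≗g x) (trans gx≡gy (sym (f≗g y))))
    g-surj : ∀ y → ∃ λ x → g x ≡ y
    g-surj y with surjective⇒strictlySurjective {f = f} f-surj y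
    ... | x , fx≡y = x , trans (sym (f≗g x)) fx≡y

  bij-∙ˡ : ∀ a → Bij G (a ∙_)
  bij-∙ˡ a = ∙-cancelˡ a _ _ , strictlySurjective⇒surjective λ y → a ⁻¹ ∙ y , \\-leftDividesˡ a y

  bij-∙ʳ : ∀ c → Bij G (_∙ c)
  bij-∙ʳ c = ∙-cancelʳ c _ _ , strictlySurjective⇒surjective λ y → y ∙ c ⁻¹ , //-rightDividesˡ c y

  section : ∀ {f} → Bij G f → Carrier → Carrier
  section {f} (_ , f-surj) y = proj₁ (surjective⇒strictlySurjective {f = f} f-surj y)

  section-correct : ∀ {f} (f-bij : Bij G f) y → f (section f-bij y) ≡ y
  section-correct {f} (_ , f-surj) y = proj₂ (surjective⇒strictlySurjective {f = f} f-surj y)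

  section⇒retraction : ∀ {f g : Carrier → Carrier} → Bij G f → (∀ y → f (g y) ≡ y) → ∀ x → g (f x) ≡ x
  section⇒retraction {f} {g} (f-inj , _) fg≗id x = f-inj (fg≗id (f x))

  bij-section : ∀ {f g : Carrier → Carrier} → Bij G f → (∀ y → f (g y) ≡ y) → Bij G g
  bij-section {f} {g} f-bij fg≗id = g-inj , strictlySurjective⇒surjective λ x → f x , gf≗id x
    where
    gf≗id : ∀ x → g (f x) ≡ x
    gf≗id = section⇒retraction {g = g} f-bij fg≗id
    g-inj : ∀ {x y} → g x ≡ g y → x ≡ y
    g-inj {x} {y} gx≡gy = trans (sym (fg≗id x)) (trans (cong f gx≡gy) (fg≗id y))

  aut-ε : ∀ {φ} → IsAut G φ → φ ε ≡ ε
  aut-ε {φ} (_ , φ-homo) =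
    identityˡ-unique (φ ε) (φ ε) (trans (sym (φ-homo ε ε)) (cong φ (identityˡ ε)))

  aut-⁻¹ : ∀ {φ} → IsAut G φ → ∀ x → φ (x ⁻¹) ≡ φ x ⁻¹
  aut-⁻¹ {φ} φ-aut@(_ , φ-homo) x = inverseʳ-unique (φ x) (φ (x ⁻¹)) (begin
    φ x ∙ φ (x ⁻¹) ≡⟨ φ-homo x (x ⁻¹) ⟨
    φ (x ∙ x ⁻¹)   ≡⟨ cong φ (inverseʳ x) ⟩
    φ ε            ≡⟨ aut-ε φ-aut ⟩
    ε              ∎)

  aut-id : IsAut G id
  aut-id = ((λ x≡y → x≡y) , strictlySurjective⇒surjective λ y → y , refl) , λ _ _ → refl

  aut-∘ : ∀ {φ ψ : Carrier → Carrier} → IsAut G φ → IsAut G ψ → IsAut G (φ ∘ ψ)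
  aut-∘ {φ} {ψ} (φ-bij , φ-homo) (ψ-bij , ψ-homo) =
    bij-∘ ψ-bij φ-bij , λ x y → trans (cong φ (ψ-homo x y)) (φ-homo (ψ x) (ψ y))

  aut-section : ∀ {φ ψ : Carrier → Carrier} → IsAut G φ → (∀ y → φ (ψ y) ≡ y) → IsAut G ψ
  aut-section {φ} {ψ} (φ-bij , φ-homo) φψ≗id = bij-section φ-bij φψ≗id , ψ-homo
    where
    ψ-homo : ∀ x y → ψ (x ∙ y) ≡ ψ x ∙ ψ y
    ψ-homo x y = proj₁ φ-bij (begin
      φ (ψ (x ∙ y))         ≡⟨ φψ≗id (x ∙ y) ⟩
      x ∙ y                 ≡⟨ cong₂ _∙_ (φψ≗id x) (φψ≗id y) ⟨
      φ (ψ x) ∙ φ (ψ y)     ≡⟨ φ-homo (ψ x) (ψ y) ⟨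
      φ (ψ x ∙ ψ y)         ∎)

  homo-reassoc : ∀ {φ} → IsAut G φ → ∀ a u v m → a ∙ φ (u ∙ v) ∙ m ≡ a ∙ φ u ∙ (φ v ∙ m)
  homo-reassoc {φ} (_ , φ-homo) a u v m = begin
    a ∙ φ (u ∙ v) ∙ m     ≡⟨ cong (λ w → a ∙ w ∙ m) (φ-homo u v) ⟩
    a ∙ (φ u ∙ φ v) ∙ m   ≡⟨ cong (_∙ m) (assoc a (φ u) (φ v)) ⟨
    a ∙ φ u ∙ φ v ∙ m     ≡⟨ assoc (a ∙ φ u) (φ v) m ⟩
    a ∙ φ u ∙ (φ v ∙ m)   ∎

  module CayleyAutotopy {α β γ : Carrier → Carrier}
                        (γ-split : ∀ x y → γ (x ∙ y) ≡ α x ∙ β y) where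

    φ : Carrier → Carrier
    φ z = α ε ⁻¹ ∙ α z

    α≗ : ∀ z → α z ≡ α ε ∙ φ z
    α≗ z = sym (\\-leftDividesˡ (α ε) (α z))

    γ≗ : ∀ x → γ x ≡ α x ∙ β ε
    γ≗ x = trans (cong γ (sym (identityʳ x))) (γ-split x ε)

    β≗ : ∀ y → β y ≡ φ y ∙ β ε
    β≗ y = begin
      β y                    ≡⟨ \\-leftDividesʳ (α ε) (β y) ⟨
      α ε ⁻¹ ∙ (α ε ∙ β y)   ≡⟨ cong (α ε ⁻¹ ∙_) (γ-split ε y) ⟨
      α ε ⁻¹ ∙ γ (ε ∙ y)     ≡⟨ cong (λ w → α ε ⁻¹ ∙ γ w) (identityˡ y) ⟩
      α ε ⁻¹ ∙ γ y           ≡⟨ cong (α ε ⁻¹ ∙_) (γ≗ y) ⟩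
      α ε ⁻¹ ∙ (α y ∙ β ε)   ≡⟨ assoc _ _ _ ⟨
      φ y ∙ β ε              ∎

    φ-homo : ∀ x y → φ (x ∙ y) ≡ φ x ∙ φ y
    φ-homo x y = ∙-cancelʳ (β ε) _ _ (begin
      φ (x ∙ y) ∙ β ε                 ≡⟨ assoc _ _ _ ⟩
      α ε ⁻¹ ∙ (α (x ∙ y) ∙ β ε)      ≡⟨ cong (α ε ⁻¹ ∙_) (γ≗ (x ∙ y)) ⟨
      α ε ⁻¹ ∙ γ (x ∙ y)              ≡⟨ cong (α ε ⁻¹ ∙_) (γ-split x y) ⟩
      α ε ⁻¹ ∙ (α x ∙ β y)            ≡⟨ cong (λ w → α ε ⁻¹ ∙ (α x ∙ w)) (β≗ y) ⟩
      α ε ⁻¹ ∙ (α x ∙ (φ y ∙ β ε))    ≡⟨ assoc _ _ _ ⟨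
      φ x ∙ (φ y ∙ β ε)               ≡⟨ assoc _ _ _ ⟨
      φ x ∙ φ y ∙ β ε                 ∎)

  module _ (t : ℕ) (μ : Fin t → Carrier → Carrier) where

    private
      Row : Carrier → Carrier → Fin (3 + t) → Carrier
      Row = row G t μ

      Θ′ : Triple G t μ → Fin (3 + t) → Carrier → Carrier
      Θ′ = Θ G t μ

    PreservesRows : (Fin (3 + t) → Carrier → Carrier) → Set
    PreservesRows σ = ∀ x y k → σ k (Row x y k) ≡ Row (σ zero x) (σ (suc zero) y) k

    autotopy⇒preservesRows : ∀ {σ} → IsAutotopy G t μ σ → PreservesRows σ
    autotopy⇒preservesRows {σ} (_ , forth , _) x y k with forth x y
    ... | x′ , y′ , maps =
      subst₂ (λ u v → σ k (Row x y k) ≡ Row u v k) (sym (maps zero)) (sym (maps (suc zero))) (maps k)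

    preservesRows⇒autotopy : ∀ {σ} → (∀ k → Bij G (σ k)) → PreservesRows σ → IsAutotopy G t μ σ
    preservesRows⇒autotopy {σ} σ-bij rows = σ-bij , (λ x y → σ zero x , σ (suc zero) y , rows x y) , back
      where
      back : ∀ x′ y′ → ∃₂ λ x y → ∀ k → σ k (Row x y k) ≡ Row x′ y′ k
      back x′ y′
        with surjective⇒strictlySurjective {f = σ zero} (proj₂ (σ-bij zero)) x′
           | surjective⇒strictlySurjective {f = σ (suc zero)} (proj₂ (σ-bij (suc zero))) y′
      ... | x , refl | y , refl = x , y , rows x y

    autotopy-resp : ∀ {σ τ} → IsAutotopy G t μ σ → (∀ k z → σ k z ≡ τ k z) → IsAutotopy G t μ τ
    autotopy-resp {σ} {τ} σ-aut σ≗τ =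
      preservesRows⇒autotopy (λ k → bij-resp (proj₁ σ-aut k) (σ≗τ k)) λ x y k → begin
        τ k (Row x y k)                     ≡⟨ σ≗τ k _ ⟨
        σ k (Row x y k)                     ≡⟨ autotopy⇒preservesRows σ-aut x y k ⟩
        Row (σ zero x) (σ (suc zero) y) k   ≡⟨ cong₂ (λ u v → Row u v k) (σ≗τ zero x) (σ≗τ (suc zero) y) ⟩
        Row (τ zero x) (τ (suc zero) y) k   ∎

    autotopy-∘ : ∀ {σ τ} → IsAutotopy G t μ σ → IsAutotopy G t μ τ →
                 IsAutotopy G t μ (λ k → σ k ∘ τ k)
    autotopy-∘ {σ} {τ} σ-aut τ-aut =
      preservesRows⇒autotopy (λ k → bij-∘ (proj₁ τ-aut k) (proj₁ σ-aut k)) λ x y k →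
        trans (cong (σ k) (autotopy⇒preservesRows τ-aut x y k))
              (autotopy⇒preservesRows σ-aut _ _ k)

    autotopy-section : ∀ {σ τ} → IsAutotopy G t μ σ → (∀ k z → σ k (τ k z) ≡ z) →
                       IsAutotopy G t μ τ
    autotopy-section {σ} {τ} σ-aut στ≗id = preservesRows⇒autotopy τ-bij λ x y k → begin
      τ k (Row x y k)                                     ≡⟨ cong (τ k) (σ-row x y k) ⟨
      τ k (σ k (Row (τ zero x) (τ (suc zero) y) k))       ≡⟨ section⇒retraction {g = τ k} (proj₁ σ-aut k) (στ≗id k) _ ⟩
      Row (τ zero x) (τ (suc zero) y) k                   ∎
      where
      τ-bij : ∀ k → Bij G (τ k)
      τ-bij k = bij-section (proj₁ σ-aut k) (στ≗id k)
      σ-row : ∀ x y k → σ k (Row (τ zero x) (τ (suc zero) y) k) ≡ Row x y k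
      σ-row x y k = trans (autotopy⇒preservesRows σ-aut _ _ k)
                          (cong₂ (λ u v → Row u v k) (στ≗id zero x) (στ≗id (suc zero) y))

    Compatible : Carrier → (Carrier → Carrier) → Set
    Compatible b φ = ∀ i y → μ i (φ y ∙ b ⁻¹) ≡ φ (μ i y) ∙ μ i (b ⁻¹)

    Θ-bij : ∀ {φ} → IsAut G φ → ∀ a b k → Bij G (Θ′ (a , b , φ) k)
    Θ-bij (φ-bij , _) a b zero                = bij-∘ φ-bij (bij-∙ˡ a)
    Θ-bij (φ-bij , _) a b (suc zero)          = bij-∘ φ-bij (bij-∙ʳ (b ⁻¹))
    Θ-bij (φ-bij , _) a b (suc (suc zero))    = bij-∘ (bij-∘ φ-bij (bij-∙ˡ a)) (bij-∙ʳ (b ⁻¹))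
    Θ-bij (φ-bij , _) a b (suc (suc (suc i))) = bij-∘ (bij-∘ φ-bij (bij-∙ˡ a)) (bij-∙ʳ (μ i (b ⁻¹)))

    Θ-preservesRows : ∀ {a b φ} → IsAut G φ → Compatible b φ → PreservesRows (Θ′ (a , b , φ))
    Θ-preservesRows φ-aut compat x y zero       = refl
    Θ-preservesRows φ-aut compat x y (suc zero) = refl
    Θ-preservesRows {a} {b} φ-aut compat x y (suc (suc zero)) = homo-reassoc φ-aut a x y (b ⁻¹)
    Θ-preservesRows {a} {b} {φ} φ-aut compat x y (suc (suc (suc i))) =
      trans (homo-reassoc φ-aut a x (μ i y) (μ i (b ⁻¹))) (cong (a ∙ φ x ∙_) (sym (compat i y)))

    inH-intro : ∀ {a b φ} → IsAut G φ → Compatible b φ → InH G t μ (a , b , φ)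
    inH-intro {a} {b} φ-aut compat =
      φ-aut , preservesRows⇒autotopy (Θ-bij φ-aut a b) (Θ-preservesRows φ-aut compat)

    inH⇒compatible : ∀ {a b φ} → InH G t μ (a , b , φ) → Compatible b φ
    inH⇒compatible {a} {b} {φ} (φ-aut , Θ-aut) i y = ∙-cancelˡ a _ _ (begin
      a ∙ μ i (φ y ∙ b ⁻¹)              ≡⟨ cong (_∙ μ i (φ y ∙ b ⁻¹)) (identityʳ a) ⟨
      a ∙ ε ∙ μ i (φ y ∙ b ⁻¹)          ≡⟨ cong (λ w → a ∙ w ∙ μ i (φ y ∙ b ⁻¹)) (aut-ε φ-aut) ⟨
      a ∙ φ ε ∙ μ i (φ y ∙ b ⁻¹)        ≡⟨ autotopy⇒preservesRows Θ-aut ε y (suc (suc (suc i))) ⟨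
      a ∙ φ (ε ∙ μ i y) ∙ μ i (b ⁻¹)    ≡⟨ cong (λ w → a ∙ φ w ∙ μ i (b ⁻¹)) (identityˡ (μ i y)) ⟩
      a ∙ φ (μ i y) ∙ μ i (b ⁻¹)        ≡⟨ assoc a _ _ ⟩
      a ∙ (φ (μ i y) ∙ μ i (b ⁻¹))      ∎)

    Θ-∙ : ∀ {p} → InH G t μ p → ∀ q k z → Θ′ (_·_ G t μ p q) k z ≡ Θ′ p k (Θ′ q k z)
    Θ-∙ {a , b , φ} p-inH@(φ-aut@(_ , φ-homo) , _) (a′ , b′ , φ′) = Θ-∙-at
      where
      ⁻¹-∙ : (b ∙ φ b′) ⁻¹ ≡ φ (b′ ⁻¹) ∙ b ⁻¹
      ⁻¹-∙ = trans (⁻¹-anti-homo-∙ b (φ b′)) (cong (_∙ b ⁻¹) (sym (aut-⁻¹ φ-aut b′)))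
      Θ-∙-zero : ∀ z → a ∙ φ a′ ∙ φ (φ′ z) ≡ a ∙ φ (a′ ∙ φ′ z)
      Θ-∙-zero z = trans (assoc a (φ a′) (φ (φ′ z))) (cong (a ∙_) (sym (φ-homo a′ (φ′ z))))
      Θ-∙-outer : ∀ z w m → a ∙ φ a′ ∙ φ (φ′ z) ∙ (φ w ∙ m) ≡ a ∙ φ (a′ ∙ φ′ z ∙ w) ∙ m
      Θ-∙-outer z w m =
        trans (cong (_∙ (φ w ∙ m)) (Θ-∙-zero z)) (sym (homo-reassoc φ-aut a (a′ ∙ φ′ z) w m))
      Θ-∙-at : ∀ k z → Θ′ (_·_ G t μ (a , b , φ) (a′ , b′ , φ′)) k z
                      ≡ Θ′ (a , b , φ) k (Θ′ (a′ , b′ , φ′) k z)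
      Θ-∙-at zero = Θ-∙-zero
      Θ-∙-at (suc zero) z = begin
        φ (φ′ z) ∙ (b ∙ φ b′) ⁻¹         ≡⟨ cong (φ (φ′ z) ∙_) ⁻¹-∙ ⟩
        φ (φ′ z) ∙ (φ (b′ ⁻¹) ∙ b ⁻¹)    ≡⟨ assoc _ _ _ ⟨
        φ (φ′ z) ∙ φ (b′ ⁻¹) ∙ b ⁻¹      ≡⟨ cong (_∙ b ⁻¹) (φ-homo (φ′ z) (b′ ⁻¹)) ⟨
        φ (φ′ z ∙ b′ ⁻¹) ∙ b ⁻¹          ∎
      Θ-∙-at (suc (suc zero)) z =
        trans (cong (a ∙ φ a′ ∙ φ (φ′ z) ∙_) ⁻¹-∙) (Θ-∙-outer z (b′ ⁻¹) (b ⁻¹))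
      Θ-∙-at (suc (suc (suc i))) z = begin
        a ∙ φ a′ ∙ φ (φ′ z) ∙ μ i ((b ∙ φ b′) ⁻¹)              ≡⟨ cong (λ w → a ∙ φ a′ ∙ φ (φ′ z) ∙ μ i w) ⁻¹-∙ ⟩
        a ∙ φ a′ ∙ φ (φ′ z) ∙ μ i (φ (b′ ⁻¹) ∙ b ⁻¹)           ≡⟨ cong (a ∙ φ a′ ∙ φ (φ′ z) ∙_) (inH⇒compatible p-inH i (b′ ⁻¹)) ⟩
        a ∙ φ a′ ∙ φ (φ′ z) ∙ (φ (μ i (b′ ⁻¹)) ∙ μ i (b ⁻¹))   ≡⟨ Θ-∙-outer z (μ i (b′ ⁻¹)) (μ i (b ⁻¹)) ⟩
        a ∙ φ (a′ ∙ φ′ z ∙ μ i (b′ ⁻¹)) ∙ μ i (b ⁻¹)           ∎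

    Θ-cong : ∀ {p q} → _≈₃_ G t μ p q → ∀ k z → Θ′ p k z ≡ Θ′ q k z
    Θ-cong {a , b , φ} (refl , refl , φ≗φ′) zero z                = cong (a ∙_) (φ≗φ′ z)
    Θ-cong {a , b , φ} (refl , refl , φ≗φ′) (suc zero) z          = cong (_∙ b ⁻¹) (φ≗φ′ z)
    Θ-cong {a , b , φ} (refl , refl , φ≗φ′) (suc (suc zero)) z    = cong (λ w → a ∙ w ∙ b ⁻¹) (φ≗φ′ z)
    Θ-cong {a , b , φ} (refl , refl , φ≗φ′) (suc (suc (suc i))) z = cong (λ w → a ∙ w ∙ μ i (b ⁻¹)) (φ≗φ′ z)

    Θ-injective : ∀ {a b φ a′ b′ φ′} → IsAut G φ → IsAut G φ′ →
                  (∀ k z → Θ′ (a , b , φ) k z ≡ Θ′ (a′ , b′ , φ′) k z) →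
                  _≈₃_ G t μ (a , b , φ) (a′ , b′ , φ′)
    Θ-injective {a} {b} {φ} {a′} {b′} {φ′} φ-aut φ′-aut Θ≗Θ′ = a≡a′ , b≡b′ , φ≗φ′
      where
      a≡a′ : a ≡ a′
      a≡a′ = begin
        a          ≡⟨ identityʳ a ⟨
        a ∙ ε      ≡⟨ cong (a ∙_) (aut-ε φ-aut) ⟨
        a ∙ φ ε    ≡⟨ Θ≗Θ′ zero ε ⟩
        a′ ∙ φ′ ε  ≡⟨ cong (a′ ∙_) (aut-ε φ′-aut) ⟩
        a′ ∙ ε     ≡⟨ identityʳ a′ ⟩
        a′         ∎
      b≡b′ : b ≡ b′
      b≡b′ = ⁻¹-injective (begin
        b ⁻¹             ≡⟨ identityˡ (b ⁻¹) ⟨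
        ε ∙ b ⁻¹         ≡⟨ cong (_∙ b ⁻¹) (aut-ε φ-aut) ⟨
        φ ε ∙ b ⁻¹       ≡⟨ Θ≗Θ′ (suc zero) ε ⟩
        φ′ ε ∙ b′ ⁻¹     ≡⟨ cong (_∙ b′ ⁻¹) (aut-ε φ′-aut) ⟩
        ε ∙ b′ ⁻¹        ≡⟨ identityˡ (b′ ⁻¹) ⟩
        b′ ⁻¹            ∎)
      φ≗φ′ : ∀ z → φ z ≡ φ′ z
      φ≗φ′ z = ∙-cancelˡ a _ _ (trans (Θ≗Θ′ zero z) (cong (_∙ φ′ z) (sym a≡a′)))

    inH-∙ : ∀ {p q} → InH G t μ p → InH G t μ q → InH G t μ (_·_ G t μ p q)
    inH-∙ {p} {q} p-inH@(φ-aut , Θp-aut) (φ′-aut , Θq-aut) =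
      aut-∘ φ-aut φ′-aut ,
      autotopy-resp (autotopy-∘ Θp-aut Θq-aut) (λ k z → sym (Θ-∙ p-inH q k z))

    module _ (μ-ε : ∀ i → μ i ε ≡ ε) where

      μ-ε⁻¹ : ∀ i → μ i (ε ⁻¹) ≡ ε
      μ-ε⁻¹ i = trans (cong (μ i) ε⁻¹≈ε) (μ-ε i)

      Θ-identity : ∀ k z → Θ′ (e₃ G t μ) k z ≡ z
      Θ-identity zero z                = identityˡ z
      Θ-identity (suc zero) z          = trans (cong (z ∙_) ε⁻¹≈ε) (identityʳ z)
      Θ-identity (suc (suc zero)) z    = trans (cong₂ _∙_ (identityˡ z) ε⁻¹≈ε) (identityʳ z)
      Θ-identity (suc (suc (suc i))) z = trans (cong₂ _∙_ (identityˡ z) (μ-ε⁻¹ i)) (identityʳ z)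

      inH-translation : ∀ a → InH G t μ (a , ε , id)
      inH-translation a = inH-intro aut-id λ i y → begin
        μ i (y ∙ ε ⁻¹)       ≡⟨ cong (λ w → μ i (y ∙ w)) ε⁻¹≈ε ⟩
        μ i (y ∙ ε)          ≡⟨ cong (μ i) (identityʳ y) ⟩
        μ i y                ≡⟨ identityʳ (μ i y) ⟨
        μ i y ∙ ε            ≡⟨ cong (μ i y ∙_) (μ-ε⁻¹ i) ⟨
        μ i y ∙ μ i (ε ⁻¹)   ∎

      inH-inverse : ∀ {p} → InH G t μ p →
                    Σ (Triple G t μ) λ q → InH G t μ q ×
                      _≈₃_ G t μ (_·_ G t μ p q) (e₃ G t μ) × _≈₃_ G t μ (_·_ G t μ q p) (e₃ G t μ)
      inH-inverse {a , b , φ} p-inH@(φ-aut@(φ-bij , _) , Θp-aut) = q , q-inH , pq≈e , qp≈e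
        where
        ψ : Carrier → Carrier
        ψ = section φ-bij
        φψ≗id : ∀ y → φ (ψ y) ≡ y
        φψ≗id = section-correct φ-bij
        ψ-aut : IsAut G ψ
        ψ-aut = aut-section φ-aut φψ≗id
        q : Triple G t μ
        q = ψ (a ⁻¹) , ψ (b ⁻¹) , ψ
        ψ-inverseˡ : ∀ x → ψ (x ⁻¹) ∙ ψ x ≡ ε
        ψ-inverseˡ x = trans (cong (_∙ ψ x) (aut-⁻¹ ψ-aut x)) (inverseˡ (ψ x))
        pq≈e : _≈₃_ G t μ (_·_ G t μ (a , b , φ) q) (e₃ G t μ)
        pq≈e = trans (cong (a ∙_) (φψ≗id (a ⁻¹))) (inverseʳ a) ,
               trans (cong (b ∙_) (φψ≗id (b ⁻¹))) (inverseʳ b) ,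
               φψ≗id
        qp≈e : _≈₃_ G t μ (_·_ G t μ q (a , b , φ)) (e₃ G t μ)
        qp≈e = ψ-inverseˡ a , ψ-inverseˡ b , section⇒retraction {g = ψ} φ-bij φψ≗id
        Θp∘Θq≗id : ∀ k z → Θ′ (a , b , φ) k (Θ′ q k z) ≡ z
        Θp∘Θq≗id k z = begin
          Θ′ (a , b , φ) k (Θ′ q k z)        ≡⟨ Θ-∙ p-inH q k z ⟨
          Θ′ (_·_ G t μ (a , b , φ) q) k z   ≡⟨ Θ-cong pq≈e k z ⟩
          Θ′ (e₃ G t μ) k z                  ≡⟨ Θ-identity k z ⟩
          z                                  ∎
        q-inH : InH G t μ q
        q-inH = ψ-aut , autotopy-section Θp-aut Θp∘Θq≗id

      module Classification {σ} (σ-aut : IsAutotopy G t μ σ) where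

        rows : PreservesRows σ
        rows = autotopy⇒preservesRows σ-aut

        open CayleyAutotopy {σ zero} {σ (suc zero)} {σ (suc (suc zero))}
                            (λ x y → rows x y (suc (suc zero)))

        triple : Triple G t μ
        triple = σ zero ε , σ (suc zero) ε ⁻¹ , φ

        φ-aut : IsAut G φ
        φ-aut = bij-∘ (proj₁ σ-aut zero) (bij-∙ˡ (σ zero ε ⁻¹)) , φ-homo

        σ≗Θ : ∀ k z → σ k z ≡ Θ′ triple k z
        σ≗Θ zero = α≗
        σ≗Θ (suc zero) z = trans (β≗ z) (cong (φ z ∙_) (sym (⁻¹-involutive _)))
        σ≗Θ (suc (suc zero)) z = trans (γ≗ z) (cong₂ _∙_ (α≗ z) (sym (⁻¹-involutive _)))
        σ≗Θ (suc (suc (suc i))) z = begin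
          σ (suc (suc (suc i))) z                        ≡⟨ cong (σ (suc (suc (suc i)))) z∙με≡z ⟨
          σ (suc (suc (suc i))) (z ∙ μ i ε)              ≡⟨ rows z ε (suc (suc (suc i))) ⟩
          σ zero z ∙ μ i (σ (suc zero) ε)                ≡⟨ cong₂ (λ u v → u ∙ μ i v) (α≗ z) (sym (⁻¹-involutive _)) ⟩
          σ zero ε ∙ φ z ∙ μ i (σ (suc zero) ε ⁻¹ ⁻¹)    ∎
          where
          z∙με≡z : z ∙ μ i ε ≡ z
          z∙με≡z = trans (cong (z ∙_) (μ-ε i)) (identityʳ z)

        triple-inH : InH G t μ triple
        triple-inH = φ-aut , autotopy-resp σ-aut σ≗Θ

        triple-unique : ∀ q → IsAut G (proj₂ (proj₂ q)) → (∀ k z → σ k z ≡ Θ′ q k z) →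
                        _≈₃_ G t μ q triple
        triple-unique q q-aut σ≗Θq =
          Θ-injective q-aut φ-aut λ k z → trans (sym (σ≗Θq k z)) (σ≗Θ k z)

corollary5p7 : (G : FinGroup) → let open FinGroup G in
    (t : ℕ) (μ : Fin t → Carrier → Carrier) →
    (∀ i → Bij G (μ i)) → (∀ i → μ i ε ≡ ε) → IsOA G t μ →
    -- every autotopy equals Θ(a,b,φ) for a unique (a,b,φ) ∈ (G × G) ⋊ Aut(G)
    ((σ : Fin (3 Data.Nat.+ t) → Carrier → Carrier) → IsAutotopy G t μ σ →
       Σ (Triple G t μ) λ p → InH G t μ p × (∀ k z → σ k z ≡ Θ G t μ p k z) ×
         (∀ (q : Triple G t μ) → IsAut G (Data.Product.proj₂ (Data.Product.proj₂ q)) →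
            (∀ k z → σ k z ≡ Θ G t μ q k z) → _≈₃_ G t μ q p)) ×
    -- H is a subgroup of (G × G) ⋊ Aut(G)
    InH G t μ (e₃ G t μ) ×
    (∀ p q → InH G t μ p → InH G t μ q → InH G t μ (_·_ G t μ p q)) ×
    (∀ p → InH G t μ p → Σ (Triple G t μ) λ q → InH G t μ q ×
       _≈₃_ G t μ (_·_ G t μ p q) (e₃ G t μ) × _≈₃_ G t μ (_·_ G t μ q p) (e₃ G t μ)) ×
    -- Θ is a homomorphism on H (autotopies composed coordinatewise)
    (∀ p q → InH G t μ p → InH G t μ q →
       ∀ k z → Θ G t μ (_·_ G t μ p q) k z ≡ Θ G t μ p k (Θ G t μ q k z)) ×
    -- H contains (G × {e}) ⋊ {id}
    (∀ a → InH G t μ (a , ε , λ z → z))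
corollary5p7 G t μ _ μ-ε _ =
  (λ σ σ-aut → let open Classification G t μ μ-ε σ-aut in
               triple , triple-inH , σ≗Θ , triple-unique) ,
  inH-translation G t μ μ-ε (FinGroup.ε G) ,
  (λ _ _ → inH-∙ G t μ) ,
  (λ _ → inH-inverse G t μ μ-ε) ,
  (λ _ q p-inH _ → Θ-∙ G t μ p-inH q) ,
  inH-translation G t μ μ-ε
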